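{- Let $p,q$ be primes with $2<p<q$. Every integer greater than $g_0$ is representable.
   Context: Let $p,q$ be primes with $2<p<q$, and put $p'=(p-1)/2$, $q'=(q-1)/2$. Set $d_0=pq$, $d_1=p'q$, $d_2=pq'$, $d_3=(pq-1)/2$, and for integers $x,y,z,w$ put $f(x,y,z,w)=xd_0+yd_1+zd_2+wd_3$. An integer is representable if it equals $f(x,y,z,w)$ for some nonnegative integers $x,y,z,w$. Define $\kappa$ by $q=\kappa p+\lambda$ with $1\le\lambda\le p-1$, and put $g_0=f(p'-1,p-1,\kappa,-1)$. -}

module Defs where

open import Data.Nat as ℕ using (ℕ; _∸_)
open import Data.Nat.DivMod using (_/_)
open import Data.Integer as ℤ using (ℤ; +_; -[1+_])
open import Data.Product using (∃; Σ; _×_; _,_)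
open import Relation.Binary.PropositionalEquality using (_≡_)

-- p' = (p-1)/2, q' = (q-1)/2 (exact for odd p, q)
half-pred : ℕ → ℕ
half-pred n = (n ∸ 1) / 2

d₀ d₁ d₂ d₃ : ℕ → ℕ → ℕ
d₀ p q = p ℕ.* q
d₁ p q = half-pred p ℕ.* q
d₂ p q = p ℕ.* half-pred q
d₃ p q = half-pred (p ℕ.* q)

f : ℕ → ℕ → ℤ → ℤ → ℤ → ℤ → ℤ
f p q x y z w =
  x ℤ.* + d₀ p q ℤ.+ y ℤ.* + d₁ p q ℤ.+ z ℤ.* + d₂ p q ℤ.+ w ℤ.* + d₃ p q

Representable : ℕ → ℕ → ℤ → Set
Representable p q n =
  ∃ λ (x : ℕ) → ∃ λ (y : ℕ) → ∃ λ (z : ℕ) → ∃ λ (w : ℕ) →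
    n ≡ f p q (+ x) (+ y) (+ z) (+ w)

-- κ with q = κ p + λ, 1 ≤ λ ≤ p-1 : since p ∤ q this is ⌊q/p⌋
-- (written q / suc (p ∸ 1), which equals q / p for p ≥ 1, to avoid a NonZero instance)
κ : (p q : ℕ) → ℕ
κ p q = q / ℕ.suc (p ∸ 1)

g₀ : (p q : ℕ) → ℤ
g₀ p q = f p q (+ half-pred p ℤ.- + 1) (+ p ℤ.- + 1) (+ κ p q) (ℤ.- + 1)

{-# OPTIONS --safe #-}
-- With P = pq = 2d₃ + 1 one has 2d₁ = P − q, 2d₂ = P − p and 2d₃ = P − 1, so m = y d₁ + z d₂ + w d₃
-- satisfies 2m + (w + z p + y q) = (y + z + w) P.  Every s < P has a mixed-radix expansion
-- s = w + z p + y q with y, w < p and w + z p < q (so z ≤ κ), which gives a representable m with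
-- P ∣ 2m + s and m ≤ g₀ + P.  For n > g₀ choose s with P ∣ 2n + s: since P is odd, n ≡ m (mod P),
-- and m < n + P forces n = m + xP.
module Submission where

open import Defs
open import Data.Nat as ℕ using (ℕ)
open import Data.Nat.Primality using (Prime)
open import Data.Integer as ℤ using (ℤ)

open import Data.Nat.Base using (zero; suc; _+_; _*_; _∸_; _≤_; _<_; s≤s; s≤s⁻¹; z≤n; ⌊_/2⌋; NonZero; >-nonZero⁻¹)
open import Data.Nat.Properties
open import Algebra.Properties.CommutativeSemigroup +-commutativeSemigroup using (xy∙z≈xz∙y; x∙yz≈yx∙z; x∙yz≈zx∙y)
open import Data.Nat.DivMod using (_/_; _%_; m≡m%n+[m/n]*n; m%n<n; m<n*o⇒m/o<n; m*n/n≡m)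
open import Data.Nat.Divisibility using (_∣_; divides)
open import Data.Nat.Primality using (composite; prime⇒¬composite)
open import Data.Nat.Tactic.RingSolver using (solve-∀)
open import Data.Integer.Base using (+_; -[1+_]; -≤+)
import Data.Integer.Properties as ℤₚ
import Data.Integer.Tactic.RingSolver as ℤ-Solver
open import Data.Product using (∃; _×_; _,_)
open import Data.Sum using (_⊎_; inj₁; inj₂)
open import Data.Empty using (⊥-elim)
open import Relation.Binary.Definitions using (tri<; tri≈; tri>)
open import Relation.Binary.PropositionalEquality

half-injective : ∀ {m n} → m + m ≡ n + n → m ≡ n
half-injective {m} {n} eq = trans (n≡⌊n+n/2⌋ m) (trans (cong ⌊_/2⌋ eq) (sym (n≡⌊n+n/2⌋ n)))

odd≢even : ∀ {m n} → suc (m + m) ≢ n + n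
odd≢even {m} {n} eq = 1+n≢n (subst (λ k → suc (k + k) ≡ n + n) m≡n eq)
  where
  m≡n : m ≡ n
  m≡n = trans (n≡⌈n+n/2⌉ m) (trans (cong ⌊_/2⌋ eq) (sym (n≡⌊n+n/2⌋ n)))

even-or-odd : ∀ n → ∃ λ k → n ≡ k + k ⊎ n ≡ suc (k + k)
even-or-odd zero = 0 , inj₁ refl
even-or-odd (suc n) with even-or-odd n
... | k , inj₁ refl = k , inj₂ refl
... | k , inj₂ refl = suc k , inj₁ (cong suc (sym (+-suc k k)))

k+k≡k*2 : ∀ k → k + k ≡ k * 2
k+k≡k*2 = solve-∀

half-pred-odd : ∀ k → half-pred (suc (k + k)) ≡ k
half-pred-odd k = trans (cong (_/ 2) (k+k≡k*2 k)) (m*n/n≡m k 2)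

odd-prime : ∀ {p} → Prime p → 2 < p → ∃ λ a → p ≡ suc (a + a)
odd-prime {p} p-prime 2<p with even-or-odd p
... | a , inj₂ p≡1+2a = a , p≡1+2a
... | a , inj₁ refl = ⊥-elim (prime⇒¬composite p-prime (composite 2<p (divides a (k+k≡k*2 a))))

pad-to-multiple : ∀ P .{{_ : NonZero P}} n → ∃ λ s → s < P × P ∣ n + s
pad-to-multiple P n with n % P in r≡
... | zero = 0 , >-nonZero⁻¹ P , divides (n / P) (begin
  n + 0 ≡⟨ +-identityʳ n ⟩
  n ≡⟨ m≡m%n+[m/n]*n n P ⟩
  n % P + n / P * P ≡⟨ cong (_+ n / P * P) r≡ ⟩
  n / P * P ∎)
  where open ≡-Reasoning
... | suc r = P ∸ suc r , ∸-monoʳ-< (s≤s z≤n) (<⇒≤ r<P) , divides (suc (n / P)) (begin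
  n + (P ∸ suc r) ≡⟨ cong (_+ (P ∸ suc r)) (trans (m≡m%n+[m/n]*n n P) (cong (_+ n / P * P) r≡)) ⟩
  suc r + n / P * P + (P ∸ suc r) ≡⟨ xy∙z≈xz∙y (suc r) (n / P * P) (P ∸ suc r) ⟩
  suc r + (P ∸ suc r) + n / P * P ≡⟨ cong (_+ n / P * P) (m+[n∸m]≡n (<⇒≤ r<P)) ⟩
  P + n / P * P ∎)
  where
  open ≡-Reasoning
  r<P : suc r < P
  r<P = subst (_< P) r≡ (m%n<n n P)

halve-odd-multiple : ∀ {P e j m n} → P ≡ suc (e + e) →
  m + m ≡ n + n + j * P → ∃ λ x → m ≡ n + x * P
halve-odd-multiple {P} {e} {j} {m} {n} refl eq with even-or-odd j
... | x , inj₁ refl = x , half-injective (trans eq (even-case n x P))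
  where
  even-case : ∀ n x P → n + n + (x + x) * P ≡ (n + x * P) + (n + x * P)
  even-case = solve-∀
... | x , inj₂ refl = ⊥-elim (odd≢even {n + x * suc (e + e) + e} {m} (trans (odd-case n x e) (sym eq)))
  where
  odd-case : ∀ n x e → suc ((n + x * suc (e + e) + e) + (n + x * suc (e + e) + e))
                     ≡ n + n + suc (x + x) * suc (e + e)
  odd-case = solve-∀

halve-difference : ∀ {P e m n s T X} → P ≡ suc (e + e) →
  m + m + s ≡ T * P → n + n + s ≡ X * P → T ≤ X → ∃ λ x → n ≡ m + x * P
halve-difference {P} {e} {m} {n} {s} {T} P-odd 2m+s≡TP 2n+s≡XP T≤X
  with m≤n⇒∃[o]m+o≡n T≤X
... | j , refl = halve-odd-multiple {e = e} {j} {n} {m} P-odd (+-cancelʳ-≡ s (n + n) (m + m + j * P) (begin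
  n + n + s ≡⟨ 2n+s≡XP ⟩
  (T + j) * P ≡⟨ *-distribʳ-+ P T j ⟩
  T * P + j * P ≡⟨ cong (_+ j * P) (sym 2m+s≡TP) ⟩
  m + m + s + j * P ≡⟨ xy∙z≈xz∙y (m + m) s (j * P) ⟩
  m + m + j * P + s ∎))
  where open ≡-Reasoning

halve-congruence : ∀ {P e m n s} → P ≡ suc (e + e) →
  P ∣ m + m + s → P ∣ n + n + s → m < n + P → ∃ λ x → n ≡ m + x * P
halve-congruence {P} {e} {m} {n} P-odd (divides T 2m+s≡TP) (divides X 2n+s≡XP) m<n+P with ≤-total T X
... | inj₁ T≤X = halve-difference {e = e} {m} {n} P-odd 2m+s≡TP 2n+s≡XP T≤X
... | inj₂ X≤T with halve-difference {e = e} {n} {m} P-odd 2n+s≡XP 2m+s≡TP X≤T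
...   | zero , m≡n+0 = 0 , trans (sym (+-identityʳ n)) (trans (sym m≡n+0) (sym (+-identityʳ m)))
...   | suc x , m≡n+[1+x]P = ⊥-elim (<⇒≱ m<n+P (begin
  n + P ≤⟨ +-monoʳ-≤ n (m≤m+n P (x * P)) ⟩
  n + suc x * P ≡⟨ sym m≡n+[1+x]P ⟩
  m ∎))
  where open ≤-Reasoning

mixed-radix : ∀ p q .{{_ : NonZero p}} .{{_ : NonZero q}} {s} → s < p * q →
  ∃ λ y → ∃ λ z → ∃ λ w → s ≡ w + z * p + y * q × y < p × w < p × w + z * p < q
mixed-radix p q {s} s<pq =
  s / q , r / p , r % p , s≡ , m<n*o⇒m/o<n s<pq , m%n<n r p ,
  subst (_< q) (m≡m%n+[m/n]*n r p) (m%n<n s q)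
  where
  r = s % q
  s≡ : s ≡ r % p + r / p * p + s / q * q
  s≡ = trans (m≡m%n+[m/n]*n s q) (cong (_+ s / q * q) (m≡m%n+[m/n]*n r p))

lexicographic-< : ∀ {p l k z w} → l < p → w + z * p < l + k * p → z < k ⊎ (z ≡ k × w < l)
lexicographic-< {p} {l} {k} {z} {w} l<p lt with <-cmp z k
... | tri< z<k _ _ = inj₁ z<k
... | tri≈ _ refl _ = inj₂ (refl , +-cancelʳ-< (z * p) w l lt)
... | tri> _ _ k<z = ⊥-elim (<-irrefl refl (begin-strict
  l + k * p <⟨ +-monoˡ-< (k * p) l<p ⟩
  suc k * p ≤⟨ *-monoˡ-≤ p k<z ⟩
  z * p ≤⟨ m≤n+m (z * p) w ⟩
  w + z * p <⟨ lt ⟩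
  l + k * p ∎))
  where open ≤-Reasoning

f-nonneg : ∀ p q x y z w →
  f p q (+ x) (+ y) (+ z) (+ w) ≡ + (x * d₀ p q + y * d₁ p q + z * d₂ p q + w * d₃ p q)
f-nonneg p q x y z w = sym (cong₂ ℤ._+_
  (cong₂ ℤ._+_ (cong₂ ℤ._+_ (ℤₚ.pos-* x (d₀ p q)) (ℤₚ.pos-* y (d₁ p q))) (ℤₚ.pos-* z (d₂ p q)))
  (ℤₚ.pos-* w (d₃ p q)))

g₀-shift : ∀ k q → g₀ (suc k) q ℤ.+ + (d₀ (suc k) q + d₃ (suc k) q)
                 ≡ f (suc k) q (+ half-pred (suc k)) (+ k) (+ κ (suc k) q) (+ 0)
g₀-shift k q = shift (+ half-pred (suc k)) (+ k) (+ κ (suc k) q)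
  (+ d₀ (suc k) q) (+ d₁ (suc k) q) (+ d₂ (suc k) q) (+ d₃ (suc k) q)
  where
  shift : ∀ x y z D₀ D₁ D₂ D₃ →
    (x ℤ.- + 1) ℤ.* D₀ ℤ.+ y ℤ.* D₁ ℤ.+ z ℤ.* D₂ ℤ.+ (ℤ.- + 1) ℤ.* D₃ ℤ.+ (D₀ ℤ.+ D₃)
    ≡ x ℤ.* D₀ ℤ.+ y ℤ.* D₁ ℤ.+ z ℤ.* D₂ ℤ.+ + 0 ℤ.* D₃
  shift = ℤ-Solver.solve-∀

-- p = 2a + 1 and q = 2b + 1. The eᵢ are the dᵢ written as polynomials in a and b (see dᵢ≡eᵢ below),
-- κ p q reduces to q / p, and H (κ p q) = f(p', p − 1, κ, 0) = g₀ + d₀ + d₃.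
module OddModuli (a b : ℕ) where

  p q P e₁ e₂ e₃ : ℕ
  p = suc (a + a)
  q = suc (b + b)
  P = p * q
  e₁ = a * q
  e₂ = p * b
  e₃ = a * q + b

  H : ℕ → ℕ
  H k = a * P + (a + a) * e₁ + k * e₂

  e₁+e₁+q≡P : e₁ + e₁ + q ≡ P
  e₁+e₁+q≡P = identity a b
    where
    identity : ∀ a b → a * suc (b + b) + a * suc (b + b) + suc (b + b) ≡ suc (a + a) * suc (b + b)
    identity = solve-∀

  e₂+e₂+p≡P : e₂ + e₂ + p ≡ P
  e₂+e₂+p≡P = identity a b
    where
    identity : ∀ a b → suc (a + a) * b + suc (a + a) * b + suc (a + a) ≡ suc (a + a) * suc (b + b)
    identity = solve-∀

  1+e₃+e₃≡P : suc (e₃ + e₃) ≡ P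
  1+e₃+e₃≡P = identity a b
    where
    identity : ∀ a b → suc ((a * suc (b + b) + b) + (a * suc (b + b) + b)) ≡ suc (a + a) * suc (b + b)
    identity = solve-∀

  p*e₃≡e₂+a*P : p * e₃ ≡ e₂ + a * P
  p*e₃≡e₂+a*P = identity a b
    where
    identity : ∀ a b → suc (a + a) * (a * suc (b + b) + b)
                     ≡ suc (a + a) * b + a * (suc (a + a) * suc (b + b))
    identity = solve-∀

  [a+a]*e₃+a≡a*P : (a + a) * e₃ + a ≡ a * P
  [a+a]*e₃+a≡a*P = identity a b
    where
    identity : ∀ a b → (a + a) * (a * suc (b + b) + b) + a ≡ a * (suc (a + a) * suc (b + b))
    identity = solve-∀

  weights-double : ∀ y z w → let m = y * e₁ + z * e₂ + w * e₃ in
    m + m + (w + z * p + y * q) ≡ (y + z + w) * P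
  weights-double y z w = begin
    m + m + (w + z * p + y * q)
      ≡⟨ regroup y z w e₁ e₂ e₃ p q ⟩
    y * (e₁ + e₁ + q) + z * (e₂ + e₂ + p) + w * suc (e₃ + e₃)
      ≡⟨ cong₂ _+_ (cong₂ _+_ (cong (y *_) e₁+e₁+q≡P) (cong (z *_) e₂+e₂+p≡P))
                   (cong (w *_) 1+e₃+e₃≡P) ⟩
    y * P + z * P + w * P
      ≡⟨ sym (trans (*-distribʳ-+ P (y + z) w) (cong (_+ w * P) (*-distribʳ-+ P y z))) ⟩
    (y + z + w) * P ∎
    where
    open ≡-Reasoning
    m = y * e₁ + z * e₂ + w * e₃
    regroup : ∀ y z w E₁ E₂ E₃ p q →
      (y * E₁ + z * E₂ + w * E₃) + (y * E₁ + z * E₂ + w * E₃) + (w + z * p + y * q)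
      ≡ y * (E₁ + E₁ + q) + z * (E₂ + E₂ + p) + w * suc (E₃ + E₃)
    regroup = solve-∀

  digit-weight-bound : ∀ {k l z w} → w < p → l < p → z < k ⊎ (z ≡ k × w < l) →
    z * e₂ + suc w * e₃ ≤ k * e₂ + a * P
  digit-weight-bound {k} {l} {z} {w} w<p _ (inj₁ z<k) = begin
    z * e₂ + suc w * e₃   ≤⟨ +-monoʳ-≤ (z * e₂) (*-monoˡ-≤ e₃ w<p) ⟩
    z * e₂ + p * e₃       ≡⟨ cong (_+_ (z * e₂)) p*e₃≡e₂+a*P ⟩
    z * e₂ + (e₂ + a * P) ≡⟨ x∙yz≈yx∙z (z * e₂) e₂ (a * P) ⟩
    suc z * e₂ + a * P    ≤⟨ +-monoˡ-≤ (a * P) (*-monoˡ-≤ e₂ z<k) ⟩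
    k * e₂ + a * P        ∎
    where open ≤-Reasoning
  digit-weight-bound {k} {l} {z} {w} _ l<p (inj₂ (refl , w<l)) = +-monoʳ-≤ (z * e₂) (begin
    suc w * e₃         ≤⟨ *-monoˡ-≤ e₃ (s≤s⁻¹ (<-≤-trans (s≤s w<l) l<p)) ⟩
    (a + a) * e₃       ≤⟨ m≤m+n ((a + a) * e₃) a ⟩
    (a + a) * e₃ + a   ≡⟨ [a+a]*e₃+a≡a*P ⟩
    a * P              ∎)
    where open ≤-Reasoning

  weight-bound : ∀ {k l y z w} → y < p → w < p → l < p → z < k ⊎ (z ≡ k × w < l) →
    y * e₁ + z * e₂ + w * e₃ + e₃ ≤ H k
  weight-bound {k} {l} {y} {z} {w} y<p w<p l<p digits = begin
    y * e₁ + z * e₂ + w * e₃ + e₃    ≡⟨ regroup (y * e₁) (z * e₂) (w * e₃) e₃ ⟩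
    y * e₁ + (z * e₂ + suc w * e₃)   ≤⟨ +-mono-≤ (*-monoˡ-≤ e₁ (s≤s⁻¹ y<p)) (digit-weight-bound w<p l<p digits) ⟩
    (a + a) * e₁ + (k * e₂ + a * P)  ≡⟨ x∙yz≈zx∙y ((a + a) * e₁) (k * e₂) (a * P) ⟩
    H k                              ∎
    where
    open ≤-Reasoning
    regroup : ∀ A B C D → A + B + C + D ≡ A + (B + (D + C))
    regroup = solve-∀

  P+e₃≤H : .{{_ : NonZero a}} → ∀ k → P + e₃ ≤ H k
  P+e₃≤H k = begin
    P + e₃                ≤⟨ +-mono-≤ (m≤n*m P a) e₃≤[a+a]*e₁ ⟩
    a * P + (a + a) * e₁  ≤⟨ m≤m+n (a * P + (a + a) * e₁) (k * e₂) ⟩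
    H k                   ∎
    where
    open ≤-Reasoning
    e₃≤[a+a]*e₁ : e₃ ≤ (a + a) * e₁
    e₃≤[a+a]*e₁ = begin
      e₁ + b           ≤⟨ +-monoʳ-≤ e₁ (≤-trans (≤-trans (m≤m+n b b) (n≤1+n _)) (m≤n*m q a)) ⟩
      e₁ + e₁          ≤⟨ +-mono-≤ (m≤n*m e₁ a) (m≤n*m e₁ a) ⟩
      a * e₁ + a * e₁  ≡⟨ *-distribʳ-+ e₁ a a ⟨
      (a + a) * e₁     ∎

  residue-representative : ∀ {s} → s < P → ∃ λ y → ∃ λ z → ∃ λ w →
    let m = y * e₁ + z * e₂ + w * e₃ in P ∣ m + m + s × m + e₃ ≤ H (κ p q)
  residue-representative {s} s<P =
    let y , z , w , s≡ , y<p , w<p , w+zp<q = mixed-radix p q s<P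
        m = y * e₁ + z * e₂ + w * e₃
        q≡l+κp = m≡m%n+[m/n]*n q p
        κ-digits = lexicographic-< {p} {q % p} {κ p q} {z} {w} (m%n<n q p)
                     (subst (w + z * p <_) q≡l+κp w+zp<q)
    in  y , z , w ,
        divides (y + z + w) (trans (cong (_+_ (m + m)) s≡) (weights-double y z w)) ,
        weight-bound {κ p q} {q % p} {y} {z} {w} y<p w<p (m%n<n q p) κ-digits

  representable-above : ∀ N → H (κ p q) < N + (P + e₃) →
    ∃ λ x → ∃ λ y → ∃ λ z → ∃ λ w → N ≡ x * P + y * e₁ + z * e₂ + w * e₃
  representable-above N H<N+P+e₃ =
    let s , s<P , P∣2N+s = pad-to-multiple P (N + N)
        y , z , w , P∣2m+s , m+e₃≤H = residue-representative s<P
        m = y * e₁ + z * e₂ + w * e₃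
        m<N+P = +-cancelʳ-< e₃ m (N + P)
          (≤-<-trans m+e₃≤H (subst (H (κ p q) <_) (sym (+-assoc N P e₃)) H<N+P+e₃))
        x , N≡m+xP = halve-congruence {P} {e₃} {m} {N} (sym 1+e₃+e₃≡P) P∣2m+s P∣2N+s m<N+P
    in  x , y , z , w , trans N≡m+xP (regroup (y * e₁) (z * e₂) (w * e₃) (x * P))
    where
    regroup : ∀ A B C D → A + B + C + D ≡ D + A + B + C
    regroup = solve-∀

  d₁≡e₁ : d₁ p q ≡ e₁
  d₁≡e₁ = cong (_* q) (half-pred-odd a)

  d₂≡e₂ : d₂ p q ≡ e₂
  d₂≡e₂ = cong (p *_) (half-pred-odd b)

  d₃≡e₃ : d₃ p q ≡ e₃
  d₃≡e₃ = trans (cong half-pred (sym 1+e₃+e₃≡P)) (half-pred-odd e₃)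

  f-weights : ∀ x y z w → f p q (+ x) (+ y) (+ z) (+ w) ≡ + (x * P + y * e₁ + z * e₂ + w * e₃)
  f-weights x y z w rewrite f-nonneg p q x y z w | d₁≡e₁ | d₂≡e₂ | d₃≡e₃ = refl

  g₀+P+e₃≡H : g₀ p q ℤ.+ + (P + e₃) ≡ + H (κ p q)
  g₀+P+e₃≡H = begin
    g₀ p q ℤ.+ + (P + e₃)
      ≡⟨ cong (λ e → g₀ p q ℤ.+ + (P + e)) d₃≡e₃ ⟨
    g₀ p q ℤ.+ + (d₀ p q + d₃ p q)
      ≡⟨ g₀-shift (a + a) q ⟩
    f p q (+ half-pred p) (+ (a + a)) (+ κ p q) (+ 0)
      ≡⟨ cong (λ x → f p q (+ x) (+ (a + a)) (+ κ p q) (+ 0)) (half-pred-odd a) ⟩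
    f p q (+ a) (+ (a + a)) (+ κ p q) (+ 0)
      ≡⟨ f-weights a (a + a) (κ p q) 0 ⟩
    + (H (κ p q) + 0)
      ≡⟨ cong +_ (+-identityʳ (H (κ p q))) ⟩
    + H (κ p q) ∎
    where open ≡-Reasoning

  H<n+P+e₃ : ∀ {n} → g₀ p q ℤ.< n → + H (κ p q) ℤ.< n ℤ.+ + (P + e₃)
  H<n+P+e₃ {n} g₀<n = subst (ℤ._< n ℤ.+ + (P + e₃)) g₀+P+e₃≡H (ℤₚ.+-monoˡ-< (+ (P + e₃)) g₀<n)

  representable-above-g₀ : .{{_ : NonZero a}} → ∀ n → g₀ p q ℤ.< n → Representable p q n
  representable-above-g₀ (+ N) g₀<n =
    let x , y , z , w , N≡ = representable-above N (ℤₚ.drop‿+<+ (H<n+P+e₃ g₀<n))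
    in  x , y , z , w , trans (cong +_ N≡) (sym (f-weights x y z w))
  representable-above-g₀ -[1+ k ] g₀<n = ⊥-elim (<⇒≱ H<P+e₃ (P+e₃≤H (κ p q)))
    where
    H<P+e₃ : H (κ p q) < P + e₃
    H<P+e₃ = ℤₚ.drop‿+<+
      (ℤₚ.<-≤-trans (H<n+P+e₃ g₀<n) (ℤₚ.+-monoˡ-≤ (+ (P + e₃)) (-≤+ {k} {0})))

proposition4p1 : (p q : ℕ) → Prime p → Prime q → 2 ℕ.< p → p ℕ.< q →
    (n : ℤ) → g₀ p q ℤ.< n → Representable p q n
proposition4p1 p q p-prime q-prime 2<p p<q
  with odd-prime p-prime 2<p | odd-prime q-prime (<-trans 2<p p<q)
... | a , refl | b , refl = OddModuli.representable-above-g₀ a b {{half-nonZero 2<p}}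
  where
  half-nonZero : ∀ {a} → 2 < suc (a + a) → NonZero a
  half-nonZero {zero} (s≤s ())
  half-nonZero {suc a} _ = _
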